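{- Let $P$ be a $\pi_{\mathsf W}$ process with $\Gamma\vdash_{\mathsf w}P$ derivable with respect to a level function $l$. If $P\xrightarrow{\tau}P'$, then $\mathrm{wt}(P')\prec\mathrm{wt}(P)$, where weights are computed with respect to $l$.
   Context: The calculus $\pi_{\mathsf W}$. Processes: $P,Q ::= \overline{x}\langle y_1,y_2\rangle.P \mid x(y_1,y_2).P$ (linear input) $\mid\ !x(y_1,y_2).P$ (server) $\mid P\mid Q \mid (\nu x)P \mid \mathbf 0$; $\tilde y$ denotes a tuple. Labelled transition system with labels $\alpha ::= x(\tilde v) \mid \overline x\langle \tilde v\rangle \mid (\nu y,\tilde b)\overline x\langle\tilde v\rangle \mid \tau$: $x(\tilde y).P \xrightarrow{x(\tilde v)} P\{\tilde v/\tilde y\}$; $!x(\tilde y).P\xrightarrow{x(\tilde v)} !x(\tilde y).P \mid P\{\tilde v/\tilde y\}$; $\overline x\langle\tilde y\rangle.P\xrightarrow{\overline x\langle\tilde y\rangle}P$; if $P\xrightarrow{\alpha}P'$ and $\mathrm{bn}(\alpha)\cap\mathrm{fn}(Q)=\emptyset$ then $P\mid Q\xrightarrow{\alpha}P'\mid Q$; if $P\xrightarrow{\alpha}P'$ and $x\notin\mathrm{n}(\alpha)$ then $(\nu x)P\xrightarrow{\alpha}(\nu x)P'$; if $P\xrightarrow{(\nu\tilde b)\overline x\langle\tilde v\rangle}P'$ and $y\in\mathrm{fn}(\tilde v)\setminus\{\tilde b,x\}$ then $(\nu y)P\xrightarrow{(\nu y,\tilde b)\overline x\langle\tilde v\rangle}P'$;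 if $P\xrightarrow{(\nu\tilde b)\overline x\langle\tilde v\rangle}P'$ ($\tilde b$ possibly empty), $Q\xrightarrow{x(\tilde v)}Q'$ and $\tilde b\cap\mathrm{fn}(Q)=\emptyset$, then $P\mid Q\xrightarrow{\tau}(\nu\tilde b)(P'\mid Q')$; parallel rules apply symmetrically. Types: $V ::= \mathsf i^n[V_1,V_2]$ (linear input) $\mid \mathsf o^n[V_1,V_2]$ (linear output) $\mid \mathsf S^n[V]$ (unrestricted server) $\mid \mathsf C^n[V]$ (unrestricted client) $\mid \mathbf{unit}$, with weights $n\in\{1,2,\dots\}$. Duality: $\overline{\mathsf i^n[V_1,V_2]}=\mathsf o^n[\overline{V_1},\overline{V_2}]$, $\overline{\mathsf o^n[V_1,V_2]}=\mathsf i^n[\overline{V_1},\overline{V_2}]$, $\overline{\mathsf S^n[V]}=\mathsf C^n[\overline V]$, $\overline{\mathsf C^n[V]}=\mathsf S^n[\overline V]$, $\overline{\mathbf{unit}}=\mathbf{unit}$. Contexts: $\Gamma ::= \cdot \mid \Gamma,x:V\mid \Gamma,x::V$, where $x::V$ abbreviates $x:(V,\overline V)$ (pairing of two complementary endpoint types; $(V,\overline V)=(\overline V,V)$), each name at most once. $\mathrm{un}(T)$ holds iff $T$ is $\mathsf S^n[V]$, $\mathsf C^n[V]$ or $\mathbf{unit}$; an entry $x::V$ is unrestricted iff $\mathrm{un}(V)$; $\mathrm{un}(\Gamma)$ iff all entries of $\Gamma$ are unrestricted. Split $\Gamma=\Gamma_1\circ\Gamma_2$: $\emptyset=\emptyset\circ\emptyset$;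 and, given $\Gamma=\Gamma_1\circ\Gamma_2$: if $\mathrm{un}(T)$ then $\Gamma,x:T=(\Gamma_1,x:T)\circ(\Gamma_2,x:T)$; if $\mathrm{un}(V)$ then $\Gamma,x::V=(\Gamma_1,x::V)\circ(\Gamma_2,x::V)$; if $\neg\mathrm{un}(V)$ then $\Gamma,x::V=(\Gamma_1,x:V)\circ(\Gamma_2,x:\overline V)=(\Gamma_1,x::V)\circ\Gamma_2=\Gamma_1\circ(\Gamma_2,x::V)$; if $\neg\mathrm{un}(T)$ then $\Gamma,x:T=(\Gamma_1,x:T)\circ\Gamma_2=\Gamma_1\circ(\Gamma_2,x:T)$. A level function is $l:\mathcal N\to\mathbb N$ on names (bound names assumed pairwise distinct) with $l(x)=n$ if $x$ is assigned (by $:$ or $::$) one of $\mathsf i^n[\cdot,\cdot],\mathsf o^n[\cdot,\cdot],\mathsf S^n[\cdot],\mathsf C^n[\cdot]$, and $l(x)$ arbitrary if $x:\mathbf{unit}$. Active outputs: $\mathrm{os}(\overline x\langle\tilde y\rangle.P)=\{x\}\cup\mathrm{os}(P)$, $\mathrm{os}(x(\tilde y).P)=\mathrm{os}(P)$, $\mathrm{os}(P\mid Q)=\mathrm{os}(P)\cup\mathrm{os}(Q)$, $\mathrm{os}((\nu x)P)=\mathrm{os}(P)$, $\mathrm{os}(\mathbf 0)=\mathrm{os}(!x(\tilde y).P)=\emptyset$. Typing rules (judgments $\Gamma\vdash_{\mathsf w}P$ and $\Gamma\vdash_{\mathsf w}x:V$, relative to $l$): Var$_1$: $\mathrm{un}(\Gamma)\Rightarrow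 \Gamma,x:V\vdash x:V$. Var$_2$: $\mathrm{un}(\Gamma)\Rightarrow\Gamma,x::V\vdash x:V$. Nil: $\mathrm{un}(\Gamma)\Rightarrow\Gamma\vdash\mathbf 0$. Par: $\Gamma_1\vdash P,\ \Gamma_2\vdash Q\Rightarrow\Gamma_1\circ\Gamma_2\vdash P\mid Q$. Res: $\Gamma,x::V\vdash P\Rightarrow\Gamma\vdash(\nu x)P$. Lin-In$_1$: $\Gamma_1,x:\mathsf i^n[V_1,V_2]\vdash x:\mathsf i^n[V_1,V_2]$, $\Gamma_2,y_1:V_1,y_2:V_2\vdash P$, $l(x)=l(y_2)$ $\Rightarrow(\Gamma_1,x:\mathsf i^n[V_1,V_2])\circ\Gamma_2\vdash x(y_1,y_2).P$. Lin-In$_2$: $\Gamma_1,x:\mathsf S^n[V]\vdash x:\mathsf S^n[V]$, $\Gamma_2,x:\mathsf S^n[V],y_1:V,y_2:\mathbf{unit}\vdash P\Rightarrow(\Gamma_1,x:\mathsf S^n[V])\circ(\Gamma_2,x:\mathsf S^n[V])\vdash x(y_1,y_2).P$. Lin-In$_3$: $\Gamma,x::\mathsf S^n[V]\vdash x:\mathsf S^n[V]$, $\Gamma,x::\mathsf S^n[V],y_1:V,y_2:\mathbf{unit}\vdash P\Rightarrow\Gamma,x::\mathsf S^n[V]\vdash x(y_1,y_2).P$. Lin-Out: $\Gamma_1,x:\mathsf o^n[V_1,V_2]\vdash x:\mathsf o^n[V_1,V_2]$, $\Gamma_2,y_1:V_1\vdash y_1:V_1$, $\Gamma_3,y_2:V_2\vdash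 P$, $l(x)=l(y_2)$ $\Rightarrow(\Gamma_1,x:\mathsf o^n[V_1,V_2])\circ(\Gamma_2,y_1:V_1)\circ(\Gamma_3,y_2::V_2)\vdash\overline x\langle y_1,y_2\rangle.P$. Un-Out$_1$: $\Gamma_1,x:\mathsf C^n[V]\vdash x:\mathsf C^n[V]$, $\Gamma_2,x:\mathsf C^n[V],y_1:V\vdash y_1:V$, $\Gamma_3,x:\mathsf C^n[V],y_2:\mathbf{unit}\vdash P$ $\Rightarrow(\Gamma_1,x:\mathsf C^n[V])\circ(\Gamma_2,x:\mathsf C^n[V],y_1:V)\circ(\Gamma_3,x:\mathsf C^n[V])\vdash\overline x\langle y_1,y_2\rangle.P$. Un-Out$_2$: the same with every $x:\mathsf C^n[V]$ replaced by $x::\mathsf C^n[V]$. Un-In$_1$: $\Gamma,x:\mathsf S^n[V]\vdash x:\mathsf S^n[V]$, $\Gamma,x:\mathsf S^n[V],y_1:V,y_2:\mathbf{unit}\vdash P$, and $l(b)<n$ for all $b\in\mathrm{os}(P)$ $\Rightarrow\Gamma,x:\mathsf S^n[V]\vdash\ !x(y_1,y_2).P$. Un-In$_2$: the same with $x::\mathsf S^n[V]$ in place of $x:\mathsf S^n[V]$. Vectors: finite sequences $\langle n_k,\dots,n_1\rangle$ of naturals; $\mathbf 1_i$ has a $1$ at position $i$ and $0$ elsewhere; $\mathbf 0$ is the zero vector. Sum: pad the shorter vector with zeros at the high positions to equal length, then add pointwise. For vectors of equal length (after such padding), $\langle n_k,\dots,n_1\rangle\prec\langle m_k,\dots,m_1\rangle$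 iff there is $i\le k$ with $n_i<m_i$ and $n_j=m_j$ for all $j>i$. Weight of a well-typed process (w.r.t. $l$): $\mathrm{wt}(\mathbf 0)=\mathbf 0$, $\mathrm{wt}(!x(\tilde y).P)=\mathbf 0$, $\mathrm{wt}(x(\tilde y).P)=\mathrm{wt}(P)$, $\mathrm{wt}(\overline x\langle\tilde y\rangle.P)=\mathrm{wt}(P)+\mathbf 1_{l(x)}$, $\mathrm{wt}(P\mid Q)=\mathrm{wt}(P)+\mathrm{wt}(Q)$, $\mathrm{wt}((\nu x)P)=\mathrm{wt}(P)$. -}

module Defs where

open import Data.Nat using (ℕ; zero; suc; _+_; _≤_; _<_; _⊔_; _≟_)
open import Data.List using (List; []; _∷_; _++_; length)
open import Data.List.Membership.Propositional using (_∈_; _∉_)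
open import Data.Maybe using (Maybe; just; nothing)
open import Data.Product using (Σ; ∃; _×_; _,_)
open import Data.Sum using (_⊎_)
open import Data.Unit using (⊤)
open import Data.Empty using (⊥)
open import Relation.Nullary using (¬_; yes; no)
open import Relation.Binary.PropositionalEquality using (_≡_; _≢_)

Name : Set
Name = ℕ

data Proc : Set where
  out  : Name → Name → Name → Proc → Proc   -- x̄⟨y1,y2⟩.P
  inp  : Name → Name → Name → Proc → Proc   -- x(y1,y2).P   (linear input)
  rep  : Name → Name → Name → Proc → Proc   -- !x(y1,y2).P  (server)
  par  : Proc → Proc → Proc
  nu   : Name → Proc → Proc
  nil  : Proc

remove : Name → List Name → List Name
remove x [] = []
remove x (z ∷ zs) with z ≟ x
... | yes _ = remove x zs
... | no  _ = z ∷ remove x zs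

fn : Proc → List Name
fn (out x y1 y2 P) = x ∷ y1 ∷ y2 ∷ fn P
fn (inp x y1 y2 P) = x ∷ remove y1 (remove y2 (fn P))
fn (rep x y1 y2 P) = x ∷ remove y1 (remove y2 (fn P))
fn (par P Q)       = fn P ++ fn Q
fn (nu x P)        = remove x (fn P)
fn nil             = []

-- renamings, and (non capture-avoiding; Barendregt convention) application
Ren : Set
Ren = Name → Name

bind : Ren → Name → Ren
bind σ y z with z ≟ y
... | yes _ = z
... | no  _ = σ z

ren : Ren → Proc → Proc
ren σ (out x y1 y2 P) = out (σ x) (σ y1) (σ y2) (ren σ P)
ren σ (inp x y1 y2 P) = inp (σ x) y1 y2 (ren (bind (bind σ y1) y2) P)
ren σ (rep x y1 y2 P) = rep (σ x) y1 y2 (ren (bind (bind σ y1) y2) P)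
ren σ (par P Q)       = par (ren σ P) (ren σ Q)
ren σ (nu x P)        = nu x (ren (bind σ x) P)
ren σ nil             = nil

sub2σ : Name → Name → Name → Name → Ren
sub2σ y1 y2 v1 v2 z with z ≟ y1
... | yes _ = v1
... | no  _ with z ≟ y2
...   | yes _ = v2
...   | no  _ = z

_[_,_/_,_] : Proc → Name → Name → Name → Name → Proc
P [ v1 , v2 / y1 , y2 ] = ren (sub2σ y1 y2 v1 v2) P

data Label : Set where
  inL  : Name → Name → Name → Label
  outL : List Name → Name → Name → Name → Label  -- (ν b̃)x̄⟨v1,v2⟩, b̃ possibly empty
  τ    : Label

bn : Label → List Name
bn (inL _ _ _)     = []
bn (outL bs _ _ _) = bs
bn τ               = []

names : Label → List Name
names (inL x v1 v2)     = x ∷ v1 ∷ v2 ∷ []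
names (outL bs x v1 v2) = bs ++ (x ∷ v1 ∷ v2 ∷ [])
names τ                 = []

Disjoint : List Name → List Name → Set
Disjoint xs ys = ∀ z → z ∈ xs → z ∉ ys

nus : List Name → Proc → Proc
nus []       R = R
nus (b ∷ bs) R = nu b (nus bs R)

infix 4 _—[_]→_
data _—[_]→_ : Proc → Label → Proc → Set where
  t-in   : ∀ {x y1 y2 v1 v2 P} →
           inp x y1 y2 P —[ inL x v1 v2 ]→ (P [ v1 , v2 / y1 , y2 ])
  t-rep  : ∀ {x y1 y2 v1 v2 P} →
           rep x y1 y2 P —[ inL x v1 v2 ]→ par (rep x y1 y2 P) (P [ v1 , v2 / y1 , y2 ])
  t-out  : ∀ {x y1 y2 P} →
           out x y1 y2 P —[ outL [] x y1 y2 ]→ P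
  t-parL : ∀ {P P' Q α} → P —[ α ]→ P' → Disjoint (bn α) (fn Q) →
           par P Q —[ α ]→ par P' Q
  t-parR : ∀ {P Q Q' α} → Q —[ α ]→ Q' → Disjoint (bn α) (fn P) →
           par P Q —[ α ]→ par P Q'
  t-res  : ∀ {x P P' α} → P —[ α ]→ P' → x ∉ names α →
           nu x P —[ α ]→ nu x P'
  t-open : ∀ {y P P' bs x v1 v2} → P —[ outL bs x v1 v2 ]→ P' →
           y ∈ (v1 ∷ v2 ∷ []) → y ∉ bs → y ≢ x →
           nu y P —[ outL (y ∷ bs) x v1 v2 ]→ P'
  t-comL : ∀ {P P' Q Q' bs x v1 v2} →
           P —[ outL bs x v1 v2 ]→ P' → Q —[ inL x v1 v2 ]→ Q' → Disjoint bs (fn Q) →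
           par P Q —[ τ ]→ nus bs (par P' Q')
  t-comR : ∀ {P P' Q Q' bs x v1 v2} →
           Q —[ outL bs x v1 v2 ]→ Q' → P —[ inL x v1 v2 ]→ P' → Disjoint bs (fn P) →
           par P Q —[ τ ]→ nus bs (par P' Q')

record ℕ⁺ : Set where
  constructor mk⁺
  field
    val  : ℕ
    .pos : 1 ≤ val
open ℕ⁺ public

data Ty : Set where
  tyI  : ℕ⁺ → Ty → Ty → Ty
  tyO  : ℕ⁺ → Ty → Ty → Ty
  tyS  : ℕ⁺ → Ty → Ty
  tyC  : ℕ⁺ → Ty → Ty
  unit : Ty

dual : Ty → Ty
dual (tyI n V1 V2) = tyO n (dual V1) (dual V2)
dual (tyO n V1 V2) = tyI n (dual V1) (dual V2)
dual (tyS n V)     = tyC n (dual V)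
dual (tyC n V)     = tyS n (dual V)
dual unit          = unit

un : Ty → Set
un (tyI _ _ _) = ⊥
un (tyO _ _ _) = ⊥
un (tyS _ _)   = ⊤
un (tyC _ _)   = ⊤
un unit        = ⊤

lev : Ty → Maybe ℕ
lev (tyI n _ _) = just (val n)
lev (tyO n _ _) = just (val n)
lev (tyS n _)   = just (val n)
lev (tyC n _)   = just (val n)
lev unit        = nothing

-- context entries:  x : V   or   x :: V  (= x : (V, V̄))
data CTy : Set where
  one  : Ty → CTy
  pair : Ty → CTy

-- (V, V̄) = (V̄, V): pair V and pair W denote the same entry iff W ≡ V or W ≡ V̄
PairEq : Ty → Ty → Set
PairEq V W = W ≡ V ⊎ W ≡ dual V

unE : CTy → Set
unE (one T)  = un T
unE (pair V) = un V

levE : CTy → Maybe ℕ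
levE (one T)  = lev T
levE (pair V) = lev V

Is : Maybe CTy → CTy → Set
Is m (one T)  = m ≡ just (one T)
Is m (pair V) = Σ Ty λ W → PairEq V W × m ≡ just (pair W)

-- contexts: finite partial maps from names to entries (each name at most once)
Ctx : Set
Ctx = Name → Maybe CTy

FiniteCtx : Ctx → Set
FiniteCtx Γ = Σ (List Name) λ xs → ∀ z → Γ z ≢ nothing → z ∈ xs

-- Γ with the entry of y set to e   (Γ, y : e  when Γ y ≡ nothing)
upd : Ctx → Name → CTy → Ctx
upd Γ y e z with z ≟ y
... | yes _ = just e
... | no  _ = Γ z

UnM : Maybe CTy → Set
UnM nothing  = ⊤
UnM (just e) = unE e

UnCtx : Ctx → Set
UnCtx Γ = ∀ z → UnM (Γ z)

data PtSplit : Maybe CTy → Maybe CTy → Maybe CTy → Set where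
  s-none  : PtSplit nothing nothing nothing
  s-un1   : ∀ {T} → un T → PtSplit (just (one T)) (just (one T)) (just (one T))
  s-un2   : ∀ {V W1 W2} → un V → PairEq V W1 → PairEq V W2 →
            PtSplit (just (pair V)) (just (pair W1)) (just (pair W2))
  s-lin2  : ∀ {V W} → ¬ un V → PairEq V W →
            PtSplit (just (pair W)) (just (one V)) (just (one (dual V)))
  s-lin2l : ∀ {V W1 W2} → ¬ un V → PairEq V W1 → PairEq V W2 →
            PtSplit (just (pair V)) (just (pair W1)) nothing
  s-lin2r : ∀ {V W1 W2} → ¬ un V → PairEq V W1 → PairEq V W2 →
            PtSplit (just (pair V)) nothing (just (pair W2))
  s-lin1l : ∀ {T} → ¬ un T → PtSplit (just (one T)) (just (one T)) nothing
  s-lin1r : ∀ {T} → ¬ un T → PtSplit (just (one T)) nothing (just (one T))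

-- Split Γ Γ1 Γ2  means  Γ = Γ1 ∘ Γ2
Split : Ctx → Ctx → Ctx → Set
Split Γ Γ1 Γ2 = ∀ z → PtSplit (Γ z) (Γ1 z) (Γ2 z)

Level : Set
Level = Name → ℕ

Resp : Level → Ctx → Set
Resp l Γ = ∀ z e n → Γ z ≡ just e → levE e ≡ just n → l z ≡ n

os : Proc → List Name
os (out x _ _ P) = x ∷ os P
os (inp _ _ _ P) = os P
os (rep _ _ _ _) = []
os (par P Q)     = os P ++ os Q
os (nu _ P)      = os P
os nil           = []

data _∣_⊢v_∶_ (l : Level) : Ctx → Name → Ty → Set where
  var1 : ∀ {Δ x V} → Resp l Δ → Δ x ≡ just (one V) → (∀ z → z ≢ x → UnM (Δ z)) →
         l ∣ Δ ⊢v x ∶ V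
  var2 : ∀ {Δ x V} → Resp l Δ → Is (Δ x) (pair V) → (∀ z → z ≢ x → UnM (Δ z)) →
         l ∣ Δ ⊢v x ∶ V

data _∣_⊢_ (l : Level) : Ctx → Proc → Set where
  t-nil  : ∀ {Δ} → Resp l Δ → UnCtx Δ → l ∣ Δ ⊢ nil
  t-par  : ∀ {Δ Δ1 Δ2 P Q} → Resp l Δ → Split Δ Δ1 Δ2 →
           l ∣ Δ1 ⊢ P → l ∣ Δ2 ⊢ Q → l ∣ Δ ⊢ par P Q
  t-res  : ∀ {Δ x V P} → Resp l Δ → Δ x ≡ nothing →
           l ∣ upd Δ x (pair V) ⊢ P → l ∣ Δ ⊢ nu x P
  t-lin-in1 : ∀ {Δ Δ1 Γ2 x y1 y2 n V1 V2 P} → Resp l Δ → Split Δ Δ1 Γ2 →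
           Δ1 x ≡ just (one (tyI n V1 V2)) → l ∣ Δ1 ⊢v x ∶ tyI n V1 V2 →
           Γ2 y1 ≡ nothing → Γ2 y2 ≡ nothing → y2 ≢ y1 →
           l ∣ upd (upd Γ2 y1 (one V1)) y2 (one V2) ⊢ P →
           l x ≡ l y2 → l ∣ Δ ⊢ inp x y1 y2 P
  t-lin-in2 : ∀ {Δ Δ1 Δ2 x y1 y2 n V P} → Resp l Δ → Split Δ Δ1 Δ2 →
           Δ1 x ≡ just (one (tyS n V)) → Δ2 x ≡ just (one (tyS n V)) →
           l ∣ Δ1 ⊢v x ∶ tyS n V →
           Δ2 y1 ≡ nothing → Δ2 y2 ≡ nothing → y2 ≢ y1 →
           l ∣ upd (upd Δ2 y1 (one V)) y2 (one unit) ⊢ P →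
           l ∣ Δ ⊢ inp x y1 y2 P
  t-lin-in3 : ∀ {Δ x y1 y2 n V P} → Resp l Δ →
           Is (Δ x) (pair (tyS n V)) → l ∣ Δ ⊢v x ∶ tyS n V →
           Δ y1 ≡ nothing → Δ y2 ≡ nothing → y2 ≢ y1 →
           l ∣ upd (upd Δ y1 (one V)) y2 (one unit) ⊢ P →
           l ∣ Δ ⊢ inp x y1 y2 P
  -- Δ = Δ1 ∘ (Δ2 ∘ Δ3) with Δ1 = Γ1,x:o^n[V1,V2], Δ2 = Γ2,y1:V1, Δ3 = Γ3,y2::V2
  t-lin-out : ∀ {Δ Δ1 Δ23 Δ2 Δ3 x y1 y2 n V1 V2 P} → Resp l Δ →
           Split Δ Δ1 Δ23 → Split Δ23 Δ2 Δ3 →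
           Δ1 x ≡ just (one (tyO n V1 V2)) → l ∣ Δ1 ⊢v x ∶ tyO n V1 V2 →
           Δ2 y1 ≡ just (one V1) → l ∣ Δ2 ⊢v y1 ∶ V1 →
           Is (Δ3 y2) (pair V2) → l ∣ upd Δ3 y2 (one V2) ⊢ P →
           l x ≡ l y2 → l ∣ Δ ⊢ out x y1 y2 P
  -- Δ = Δ1 ∘ (Δ2 ∘ Δ3) with Δ1 = Γ1,x:C, Δ2 = Γ2,x:C,y1:V, Δ3 = Γ3,x:C
  t-un-out1 : ∀ {Δ Δ1 Δ23 Δ2 Δ3 x y1 y2 n V P} → Resp l Δ →
           Split Δ Δ1 Δ23 → Split Δ23 Δ2 Δ3 →
           Δ1 x ≡ just (one (tyC n V)) → l ∣ Δ1 ⊢v x ∶ tyC n V →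
           Δ2 x ≡ just (one (tyC n V)) → y1 ≢ x → Δ2 y1 ≡ just (one V) →
           l ∣ Δ2 ⊢v y1 ∶ V →
           Δ3 x ≡ just (one (tyC n V)) → Δ3 y2 ≡ nothing →
           l ∣ upd Δ3 y2 (one unit) ⊢ P →
           l ∣ Δ ⊢ out x y1 y2 P
  t-un-out2 : ∀ {Δ Δ1 Δ23 Δ2 Δ3 x y1 y2 n V P} → Resp l Δ →
           Split Δ Δ1 Δ23 → Split Δ23 Δ2 Δ3 →
           Is (Δ1 x) (pair (tyC n V)) → l ∣ Δ1 ⊢v x ∶ tyC n V →
           Is (Δ2 x) (pair (tyC n V)) → y1 ≢ x → Δ2 y1 ≡ just (one V) →
           l ∣ Δ2 ⊢v y1 ∶ V →
           Is (Δ3 x) (pair (tyC n V)) → Δ3 y2 ≡ nothing →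
           l ∣ upd Δ3 y2 (one unit) ⊢ P →
           l ∣ Δ ⊢ out x y1 y2 P
  t-un-in1 : ∀ {Δ x y1 y2 n V P} → Resp l Δ →
           Δ x ≡ just (one (tyS n V)) → l ∣ Δ ⊢v x ∶ tyS n V →
           Δ y1 ≡ nothing → Δ y2 ≡ nothing → y2 ≢ y1 →
           l ∣ upd (upd Δ y1 (one V)) y2 (one unit) ⊢ P →
           (∀ b → b ∈ os P → l b < val n) →
           l ∣ Δ ⊢ rep x y1 y2 P
  t-un-in2 : ∀ {Δ x y1 y2 n V P} → Resp l Δ →
           Is (Δ x) (pair (tyS n V)) → l ∣ Δ ⊢v x ∶ tyS n V →
           Δ y1 ≡ nothing → Δ y2 ≡ nothing → y2 ≢ y1 →
           l ∣ upd (upd Δ y1 (one V)) y2 (one unit) ⊢ P →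
           (∀ b → b ∈ os P → l b < val n) →
           l ∣ Δ ⊢ rep x y1 y2 P

-- Vectors ⟨n_k,…,n_1⟩, represented as lists [n_1, …, n_k] (lowest position first)

Vector : Set
Vector = List ℕ

-- component at position i (1-based); 0 beyond the length (zero padding)
at : Vector → ℕ → ℕ
at xs       zero          = 0
at []       (suc _)       = 0
at (x ∷ xs) (suc zero)    = x
at (x ∷ xs) (suc (suc i)) = at xs (suc i)

zeroV : Vector
zeroV = []

-- 𝟏_i  (i ≥ 1; 𝟏_0 is taken to be 𝟎, never used for well-typed processes)
unitV : ℕ → Vector
unitV zero          = []
unitV (suc zero)    = 1 ∷ []
unitV (suc (suc i)) = 0 ∷ unitV (suc i)

_+V_ : Vector → Vector → Vector
[]       +V ys       = ys
(x ∷ xs) +V []       = x ∷ xs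
(x ∷ xs) +V (y ∷ ys) = (x + y) ∷ (xs +V ys)

-- lexicographic order (comparison from the highest position), after padding to
-- the common length k
_≺_ : Vector → Vector → Set
ns ≺ ms = Σ ℕ λ i → 1 ≤ i × i ≤ k × at ns i < at ms i
            × (∀ j → i < j → j ≤ k → at ns j ≡ at ms j)
  where k = length ns ⊔ length ms

wt : Level → Proc → Vector
wt l nil             = zeroV
wt l (rep _ _ _ _)   = zeroV
wt l (inp _ _ _ P)   = wt l P
wt l (out x _ _ P)   = wt l P +V unitV (l x)
wt l (par P Q)       = wt l P +V wt l Q
wt l (nu _ P)        = wt l P

-- A communication along x consumes one output at level l x, so the weight loses 1 at
-- position l x.  What is gained is the weight of the continuation of the receiver: a linear
-- receiver contributes nothing new, since substituting the transmitted names, which carry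
-- the levels of the formal parameters, does not change the levels of active outputs; a
-- server spawns a copy of its body, whose active outputs all lie strictly below l x.  Hence
-- the weight drops in the lexicographic order, the gain being confined to positions below l x.
module Submission where

open import Defs
open import Data.Nat using (ℕ; zero; suc; _+_; _≤_; _<_; _⊔_; _≟_; _≤?_; z≤n; s≤s)
open import Data.Nat.Properties
open import Data.List using (List; []; _∷_; length)
open import Data.List.Membership.Propositional using (_∈_; _∉_)
open import Data.List.Membership.Propositional.Properties using (∈-++⁺ˡ; ∈-++⁺ʳ; ∈-++⁻)
open import Data.List.Relation.Unary.Any using (here; there)
open import Data.Maybe using (Maybe; just; nothing)
open import Data.Product using (Σ; _×_; _,_; proj₁; proj₂)
open import Data.Sum using (inj₁; inj₂)
open import Data.Unit using (tt)
open import Data.Empty using (⊥)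
open import Relation.Nullary using (yes; no)
open import Relation.Nullary.Decidable using (recompute)
open import Relation.Binary.PropositionalEquality

at-[] : ∀ i → at [] i ≡ 0
at-[] zero    = refl
at-[] (suc i) = refl

at-+V : ∀ xs ys i → at (xs +V ys) i ≡ at xs i + at ys i
at-+V xs       ys       zero          = refl
at-+V []       ys       (suc i)       = refl
at-+V (x ∷ xs) []       (suc i)       = sym (+-identityʳ _)
at-+V (x ∷ xs) (y ∷ ys) (suc zero)    = refl
at-+V (x ∷ xs) (y ∷ ys) (suc (suc i)) = at-+V xs ys (suc i)

at-beyond-length : ∀ xs i → length xs < i → at xs i ≡ 0
at-beyond-length xs       zero          _         = refl
at-beyond-length []       (suc i)       _         = refl
at-beyond-length (x ∷ xs) (suc (suc i)) (s≤s lt)  = at-beyond-length xs (suc i) lt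

at-unitV-self : ∀ n → 1 ≤ n → at (unitV n) n ≡ 1
at-unitV-self (suc zero)    _ = refl
at-unitV-self (suc (suc n)) _ = at-unitV-self (suc n) (s≤s z≤n)

at-unitV-other : ∀ n i → i ≢ n → at (unitV n) i ≡ 0
at-unitV-other n             zero          _   = refl
at-unitV-other zero          (suc i)       _   = refl
at-unitV-other (suc zero)    (suc zero)    i≢n with () ← i≢n refl
at-unitV-other (suc zero)    (suc (suc i)) _   = refl
at-unitV-other (suc (suc n)) (suc zero)    _   = refl
at-unitV-other (suc (suc n)) (suc (suc i)) i≢n =
  at-unitV-other (suc n) (suc i) (λ i≡n → i≢n (cong suc i≡n))

+V-identityʳ : ∀ xs → xs +V [] ≡ xs
+V-identityʳ []       = refl
+V-identityʳ (x ∷ xs) = refl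

+V-comm : ∀ xs ys → xs +V ys ≡ ys +V xs
+V-comm []       []       = refl
+V-comm []       (y ∷ ys) = refl
+V-comm (x ∷ xs) []       = refl
+V-comm (x ∷ xs) (y ∷ ys) = cong₂ _∷_ (+-comm x y) (+V-comm xs ys)

+V-assoc : ∀ xs ys zs → (xs +V ys) +V zs ≡ xs +V (ys +V zs)
+V-assoc []       ys       zs       = refl
+V-assoc (x ∷ xs) []       zs       = refl
+V-assoc (x ∷ xs) (y ∷ ys) []       = refl
+V-assoc (x ∷ xs) (y ∷ ys) (z ∷ zs) = cong₂ _∷_ (+-assoc x y z) (+V-assoc xs ys zs)

+V-swapʳ : ∀ xs ys zs → (xs +V ys) +V zs ≡ (xs +V zs) +V ys
+V-swapʳ xs ys zs = begin
  (xs +V ys) +V zs  ≡⟨ +V-assoc xs ys zs ⟩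
  xs +V (ys +V zs)  ≡⟨ cong (xs +V_) (+V-comm ys zs) ⟩
  xs +V (zs +V ys)  ≡⟨ +V-assoc xs zs ys ⟨
  (xs +V zs) +V ys  ∎
  where open ≡-Reasoning

Lex : Vector → Vector → Set
Lex xs ys = Σ ℕ λ i → 1 ≤ i × at xs i < at ys i × (∀ j → i < j → at xs j ≡ at ys j)

Lex⇒≺ : ∀ {xs ys} → Lex xs ys → xs ≺ ys
Lex⇒≺ {xs} {ys} (i , 1≤i , lt , above) =
  i , 1≤i , ≤-trans i≤len (m≤n⊔m (length xs) (length ys)) , lt , λ j i<j _ → above j i<j
  where
  i≤len : i ≤ length ys
  i≤len = ≮⇒≥ λ len<i → n≮0 (subst (at xs i <_) (at-beyond-length ys i len<i) lt)

≺⇒Lex : ∀ {xs ys} → xs ≺ ys → Lex xs ys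
≺⇒Lex {xs} {ys} (i , 1≤i , _ , lt , above) = i , 1≤i , lt , above'
  where
  above' : ∀ j → i < j → at xs j ≡ at ys j
  above' j i<j with j ≤? length xs ⊔ length ys
  ... | yes j≤k = above j i<j j≤k
  ... | no  j≰k = trans (at-beyond-length xs j (≤-<-trans (m≤m⊔n _ _) (≰⇒> j≰k)))
                        (sym (at-beyond-length ys j (≤-<-trans (m≤n⊔m _ _) (≰⇒> j≰k))))

≺-+V-monoˡ : ∀ {xs ys} zs → xs ≺ ys → (xs +V zs) ≺ (ys +V zs)
≺-+V-monoˡ {xs} {ys} zs xs≺ys with ≺⇒Lex xs≺ys
... | i , 1≤i , lt , above = Lex⇒≺ (i , 1≤i , lt' , above')
  where
  lt' : at (xs +V zs) i < at (ys +V zs) i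
  lt' = subst₂ _<_ (sym (at-+V xs zs i)) (sym (at-+V ys zs i)) (+-monoˡ-< (at zs i) lt)
  above' : ∀ j → i < j → at (xs +V zs) j ≡ at (ys +V zs) j
  above' j i<j = subst₂ _≡_ (sym (at-+V xs zs j)) (sym (at-+V ys zs j))
                        (cong (_+ at zs j) (above j i<j))

≺-+V-monoʳ : ∀ {xs ys} zs → xs ≺ ys → (zs +V xs) ≺ (zs +V ys)
≺-+V-monoʳ {xs} {ys} zs xs≺ys =
  subst₂ _≺_ (+V-comm xs zs) (+V-comm ys zs) (≺-+V-monoˡ zs xs≺ys)

Below : ℕ → Vector → Set
Below n ds = ∀ j → n ≤ j → at ds j ≡ 0

+V-below-≺-+V-unitV : ∀ xs {ds n} → 1 ≤ n → Below n ds → (xs +V ds) ≺ (xs +V unitV n)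
+V-below-≺-+V-unitV xs {ds} {n} 1≤n ds<n = Lex⇒≺ (n , 1≤n , lt , above)
  where
  lt : at (xs +V ds) n < at (xs +V unitV n) n
  lt rewrite at-+V xs ds n | at-+V xs (unitV n) n | ds<n n ≤-refl | at-unitV-self n 1≤n =
    +-monoʳ-< (at xs n) (s≤s z≤n)
  above : ∀ j → n < j → at (xs +V ds) j ≡ at (xs +V unitV n) j
  above j n<j rewrite at-+V xs ds j | at-+V xs (unitV n) j | ds<n j (<⇒≤ n<j)
                    | at-unitV-other n j (>⇒≢ n<j) = refl

handshake-≺ : ∀ {S S' R R' n ds} → 1 ≤ n → Below n ds →
              S ≡ S' +V unitV n → R' ≡ R +V ds → (S' +V R') ≺ (S +V R)
handshake-≺ {S} {S'} {R} {R'} {n} {ds} 1≤n ds<n refl refl =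
  subst₂ _≺_ (+V-assoc S' R ds) (+V-swapʳ S' R (unitV n))
         (+V-below-≺-+V-unitV (S' +V R) 1≤n ds<n)

wt-nus : ∀ l bs R → wt l (nus bs R) ≡ wt l R
wt-nus l []       R = refl
wt-nus l (b ∷ bs) R = wt-nus l bs R

wt-below : ∀ l n P → (∀ b → b ∈ os P → l b < n) → Below n (wt l P)
wt-below l n (out x _ _ P) os<n j n≤j
  rewrite at-+V (wt l P) (unitV (l x)) j
        | wt-below l n P (λ b b∈ → os<n b (there b∈)) j n≤j
        | at-unitV-other (l x) j (>⇒≢ (<-≤-trans (os<n x (here refl)) n≤j)) = refl
wt-below l n (inp _ _ _ P) os<n = wt-below l n P os<n
wt-below l n (rep _ _ _ _) os<n j _ = at-[] j
wt-below l n (par P Q) os<n j n≤j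
  rewrite at-+V (wt l P) (wt l Q) j
        | wt-below l n P (λ b b∈ → os<n b (∈-++⁺ˡ b∈)) j n≤j
        | wt-below l n Q (λ b b∈ → os<n b (∈-++⁺ʳ (os P) b∈)) j n≤j = refl
wt-below l n (nu _ P) os<n = wt-below l n P os<n
wt-below l n nil os<n j _ = at-[] j

PreservesLevelsOn : Level → Ren → List Name → Set
PreservesLevelsOn l σ S = ∀ b → b ∈ S → l (σ b) ≡ l b

bind-preservesLevels : ∀ l σ y S → PreservesLevelsOn l σ S → PreservesLevelsOn l (bind σ y) S
bind-preservesLevels l σ y S σ-ok b b∈ with b ≟ y
... | yes _ = refl
... | no  _ = σ-ok b b∈

sub2σ-preservesLevels : ∀ l y1 y2 v1 v2 S → (y1 ∈ S → l v1 ≡ l y1) → (y2 ∈ S → l v2 ≡ l y2) →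
                        PreservesLevelsOn l (sub2σ y1 y2 v1 v2) S
sub2σ-preservesLevels l y1 y2 v1 v2 S ok1 ok2 b b∈ with b ≟ y1
... | yes refl = ok1 b∈
... | no  _ with b ≟ y2
...   | yes refl = ok2 b∈
...   | no  _    = refl

wt-ren : ∀ l σ P → PreservesLevelsOn l σ (os P) → wt l (ren σ P) ≡ wt l P
wt-ren l σ (out x _ _ P) σ-ok =
  cong₂ _+V_ (wt-ren l σ P (λ b b∈ → σ-ok b (there b∈))) (cong unitV (σ-ok x (here refl)))
wt-ren l σ (inp _ y1 y2 P) σ-ok =
  wt-ren l _ P (bind-preservesLevels l _ y2 _ (bind-preservesLevels l σ y1 _ σ-ok))
wt-ren l σ (rep _ _ _ _) σ-ok = refl
wt-ren l σ (par P Q) σ-ok =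
  cong₂ _+V_ (wt-ren l σ P (λ b b∈ → σ-ok b (∈-++⁺ˡ b∈)))
             (wt-ren l σ Q (λ b b∈ → σ-ok b (∈-++⁺ʳ (os P) b∈)))
wt-ren l σ (nu x P) σ-ok = wt-ren l (bind σ x) P (bind-preservesLevels l σ x _ σ-ok)
wt-ren l σ nil σ-ok = refl

ℕ⁺-pos : (n : ℕ⁺) → 1 ≤ val n
ℕ⁺-pos (mk⁺ v p) = recompute (1 ≤? v) p

dual-involutive : ∀ V → dual (dual V) ≡ V
dual-involutive (tyI n A B) = cong₂ (tyI n) (dual-involutive A) (dual-involutive B)
dual-involutive (tyO n A B) = cong₂ (tyO n) (dual-involutive A) (dual-involutive B)
dual-involutive (tyS n A)   = cong (tyS n) (dual-involutive A)
dual-involutive (tyC n A)   = cong (tyC n) (dual-involutive A)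
dual-involutive unit        = refl

lev-dual : ∀ V → lev (dual V) ≡ lev V
lev-dual (tyI _ _ _) = refl
lev-dual (tyO _ _ _) = refl
lev-dual (tyS _ _)   = refl
lev-dual (tyC _ _)   = refl
lev-dual unit        = refl

PairEq-refl : ∀ {V} → PairEq V V
PairEq-refl = inj₁ refl

PairEq-sym : ∀ {V W} → PairEq V W → PairEq W V
PairEq-sym (inj₁ refl) = inj₁ refl
PairEq-sym {V} (inj₂ refl) = inj₂ (sym (dual-involutive V))

PairEq-trans : ∀ {U V W} → PairEq U V → PairEq V W → PairEq U W
PairEq-trans (inj₁ refl) VW          = VW
PairEq-trans (inj₂ refl) (inj₁ refl) = inj₂ refl
PairEq-trans {U} (inj₂ refl) (inj₂ refl) = inj₁ (dual-involutive U)

PairEq-dual : ∀ V → PairEq V (dual V)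
PairEq-dual V = inj₂ refl

lev-PairEq : ∀ {V W} → PairEq V W → lev W ≡ lev V
lev-PairEq (inj₁ refl) = refl
lev-PairEq {V} (inj₂ refl) = lev-dual V

Assigns : Maybe CTy → Ty → Set
Assigns nothing         T = ⊥
Assigns (just (one T₀)) T = T₀ ≡ T
Assigns (just (pair V)) T = PairEq V T

Assigns-one : ∀ {m T} → m ≡ just (one T) → Assigns m T
Assigns-one refl = refl

Assigns-pair : ∀ {m V} → Is m (pair V) → Assigns m V
Assigns-pair (_ , VW , refl) = PairEq-sym VW

Assigns-splitˡ : ∀ {p a b T} → PtSplit p a b → Assigns a T → Assigns p T
Assigns-splitˡ (s-un1 _)          aT = aT
Assigns-splitˡ (s-un2 _ VW₁ _)    aT = PairEq-trans VW₁ aT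
Assigns-splitˡ (s-lin2 _ VW)      refl = PairEq-sym VW
Assigns-splitˡ (s-lin2l _ VW₁ _)  aT = PairEq-trans VW₁ aT
Assigns-splitˡ (s-lin1l _)        aT = aT

Assigns-splitʳ : ∀ {p a b T} → PtSplit p a b → Assigns b T → Assigns p T
Assigns-splitʳ (s-un1 _)          bT = bT
Assigns-splitʳ (s-un2 _ _ VW₂)    bT = PairEq-trans VW₂ bT
Assigns-splitʳ (s-lin2 {V} _ VW)  refl = PairEq-trans (PairEq-sym VW) (PairEq-dual V)
Assigns-splitʳ (s-lin2r _ _ VW₂)  bT = PairEq-trans VW₂ bT
Assigns-splitʳ (s-lin1r _)        bT = bT

Assigns-unique : ∀ {m T T'} → Assigns m T → Assigns m T' → PairEq T T'
Assigns-unique {just (one _)}  refl refl = PairEq-refl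
Assigns-unique {just (pair _)} VT   VT'  = PairEq-trans (PairEq-sym VT) VT'

Assigns-level : ∀ {l Δ x T k} → Resp l Δ → Assigns (Δ x) T → lev T ≡ just k → l x ≡ k
Assigns-level {Δ = Δ} {x} rs xT levT with Δ x in Δx
Assigns-level {x = x} rs refl levT | just (one T) = rs x (one T) _ Δx levT
Assigns-level {x = x} rs VT   levT | just (pair V) =
  rs x (pair V) _ Δx (trans (sym (lev-PairEq VT)) levT)

upd-same : ∀ Δ y e → upd Δ y e y ≡ just e
upd-same Δ y e with y ≟ y
... | yes _   = refl
... | no  y≢y with () ← y≢y refl

upd-other : ∀ Δ y e z → z ≢ y → upd Δ y e z ≡ Δ z
upd-other Δ y e z z≢y with z ≟ y
... | yes z≡y with () ← z≢y z≡y
... | no  _   = refl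

upd-keeps : ∀ (Δ : Ctx) z e' {y e} → Δ y ≡ just e → Δ z ≡ nothing → upd Δ z e' y ≡ just e
upd-keeps Δ z e' {y} Δy Δz = trans (upd-other Δ z e' y y≢z) Δy
  where
  y≢z : y ≢ z
  y≢z refl with () ← trans (sym Δy) Δz

upd₂-keeps : ∀ (Δ : Ctx) y1 y2 e1 e2 {y e} → Δ y ≡ just e → Δ y1 ≡ nothing → Δ y2 ≡ nothing →
             y2 ≢ y1 → upd (upd Δ y1 e1) y2 e2 y ≡ just e
upd₂-keeps Δ y1 y2 e1 e2 {y} Δy Δy1 Δy2 y2≢y1 =
  upd-keeps (upd Δ y1 e1) y2 e2 {y} (upd-keeps Δ y1 e1 {y} Δy Δy1)
            (trans (upd-other Δ y1 e1 y2 y2≢y1) Δy2)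

upd₂-first : ∀ Δ y1 y2 e1 e2 → y2 ≢ y1 → upd (upd Δ y1 e1) y2 e2 y1 ≡ just e1
upd₂-first Δ y1 y2 e1 e2 y2≢y1 =
  trans (upd-other (upd Δ y1 e1) y2 e2 y1 (≢-sym y2≢y1)) (upd-same Δ y1 e1)

PtSplit-unit : ∀ {p a b} → PtSplit p a b → p ≡ just (one unit) →
               a ≡ just (one unit) × b ≡ just (one unit)
PtSplit-unit (s-un1 _)   refl = refl , refl
PtSplit-unit (s-lin1l ¬u) refl with () ← ¬u tt
PtSplit-unit (s-lin1r ¬u) refl with () ← ¬u tt

⊢-resp : ∀ {l Δ P} → l ∣ Δ ⊢ P → Resp l Δ
⊢-resp (t-nil r _)                          = r
⊢-resp (t-par r _ _ _)                      = r
⊢-resp (t-res r _ _)                        = r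
⊢-resp (t-lin-in1 r _ _ _ _ _ _ _ _)        = r
⊢-resp (t-lin-in2 r _ _ _ _ _ _ _ _)        = r
⊢-resp (t-lin-in3 r _ _ _ _ _ _)            = r
⊢-resp (t-lin-out r _ _ _ _ _ _ _ _ _)      = r
⊢-resp (t-un-out1 r _ _ _ _ _ _ _ _ _ _ _)  = r
⊢-resp (t-un-out2 r _ _ _ _ _ _ _ _ _ _ _)  = r
⊢-resp (t-un-in1 r _ _ _ _ _ _ _)           = r
⊢-resp (t-un-in2 r _ _ _ _ _ _ _)           = r

⊢v-resp : ∀ {l Δ x V} → l ∣ Δ ⊢v x ∶ V → Resp l Δ
⊢v-resp (var1 r _ _) = r
⊢v-resp (var2 r _ _) = r

-- Names of type unit have arbitrary levels; substituting for them is harmless only because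
-- they are never active outputs.
unit-∉-os : ∀ {l Δ P y} → l ∣ Δ ⊢ P → Δ y ≡ just (one unit) → y ∉ os P
unit-∉-os {P = par P Q} {y} (t-par _ sp ⊢P ⊢Q) Δy y∈ with ∈-++⁻ (os P) y∈
... | inj₁ y∈P = unit-∉-os ⊢P (proj₁ (PtSplit-unit (sp y) Δy)) y∈P
... | inj₂ y∈Q = unit-∉-os ⊢Q (proj₂ (PtSplit-unit (sp y) Δy)) y∈Q
unit-∉-os {Δ = Δ} (t-res {x = x} _ Δx ⊢P) Δy =
  unit-∉-os ⊢P (upd-keeps Δ x _ Δy Δx)
unit-∉-os {y = y} (t-lin-in1 {Γ2 = Γ2} {y1 = y1} {y2} _ sp _ _ Γy1 Γy2 y2≢y1 ⊢P _) Δy =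
  unit-∉-os ⊢P (upd₂-keeps Γ2 y1 y2 _ _ (proj₂ (PtSplit-unit (sp y) Δy)) Γy1 Γy2 y2≢y1)
unit-∉-os {y = y} (t-lin-in2 {Δ2 = Δ2} {y1 = y1} {y2} _ sp _ _ _ Δy1 Δy2 y2≢y1 ⊢P) Δy =
  unit-∉-os ⊢P (upd₂-keeps Δ2 y1 y2 _ _ (proj₂ (PtSplit-unit (sp y) Δy)) Δy1 Δy2 y2≢y1)
unit-∉-os {Δ = Δ} (t-lin-in3 {y1 = y1} {y2} _ _ _ Δy1 Δy2 y2≢y1 ⊢P) Δy =
  unit-∉-os ⊢P (upd₂-keeps Δ y1 y2 _ _ Δy Δy1 Δy2 y2≢y1)
unit-∉-os {y = y} (t-lin-out _ sp sp' Δx _ _ _ _ _ _) Δy (here refl)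
  with () ← trans (sym (proj₁ (PtSplit-unit (sp y) Δy))) Δx
unit-∉-os {y = y} (t-lin-out {Δ3 = Δ3} {y2 = y2} _ sp sp' _ _ _ _ (_ , _ , Δy2) ⊢P _) Δy (there y∈) =
  unit-∉-os ⊢P (trans (upd-other Δ3 y2 _ y y≢y2) Δ3y) y∈
  where
  Δ3y : Δ3 y ≡ just (one unit)
  Δ3y = proj₂ (PtSplit-unit (sp' y) (proj₂ (PtSplit-unit (sp y) Δy)))
  y≢y2 : y ≢ y2
  y≢y2 refl with () ← trans (sym Δ3y) Δy2
unit-∉-os {y = y} (t-un-out1 _ sp _ Δx _ _ _ _ _ _ _ _) Δy (here refl)
  with () ← trans (sym (proj₁ (PtSplit-unit (sp y) Δy))) Δx
unit-∉-os {y = y} (t-un-out1 {Δ3 = Δ3} {y2 = y2} _ sp sp' _ _ _ _ _ _ _ Δy2 ⊢P) Δy (there y∈) =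
  unit-∉-os ⊢P (upd-keeps Δ3 y2 _ (proj₂ (PtSplit-unit (sp' y) (proj₂ (PtSplit-unit (sp y) Δy)))) Δy2)
            y∈
unit-∉-os {y = y} (t-un-out2 _ sp _ (_ , _ , Δx) _ _ _ _ _ _ _ _) Δy (here refl)
  with () ← trans (sym (proj₁ (PtSplit-unit (sp y) Δy))) Δx
unit-∉-os {y = y} (t-un-out2 {Δ3 = Δ3} {y2 = y2} _ sp sp' _ _ _ _ _ _ _ Δy2 ⊢P) Δy (there y∈) =
  unit-∉-os ⊢P (upd-keeps Δ3 y2 _ (proj₂ (PtSplit-unit (sp' y) (proj₂ (PtSplit-unit (sp y) Δy)))) Δy2)
            y∈

record LevelOf (l : Level) (v : Name) (A : Ty) : Set where
  constructor levelOf
  field level≡ : ∀ k → lev A ≡ just k → l v ≡ k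
open LevelOf

LevelOf-dual : ∀ {l v} A → LevelOf l v A → LevelOf l v (dual A)
LevelOf-dual A vA = levelOf λ k levA → level≡ vA k (trans (sym (lev-dual A)) levA)

≡⇒LevelOf : ∀ {l Δ y v A} → Resp l Δ → Δ y ≡ just (one A) → l v ≡ l y → LevelOf l v A
≡⇒LevelOf {A = A} rs Δy v≡y = levelOf λ k levA → trans v≡y (rs _ (one A) k Δy levA)

LevelOf⇒≡ : ∀ {l Δ y v A k} → Resp l Δ → Δ y ≡ just (one A) → LevelOf l v A → lev A ≡ just k →
            l v ≡ l y
LevelOf⇒≡ {A = A} rs Δy vA levA = trans (level≡ vA _ levA) (sym (rs _ (one A) _ Δy levA))

level-of-active-output : ∀ {l Δ P y v} A → l ∣ Δ ⊢ P → Δ y ≡ just (one A) →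
                         LevelOf l v A → y ∈ os P → l v ≡ l y
level-of-active-output unit        ⊢P Δy _  y∈ with () ← unit-∉-os ⊢P Δy y∈
level-of-active-output (tyI _ _ _) ⊢P Δy vA _ = LevelOf⇒≡ (⊢-resp ⊢P) Δy vA refl
level-of-active-output (tyO _ _ _) ⊢P Δy vA _ = LevelOf⇒≡ (⊢-resp ⊢P) Δy vA refl
level-of-active-output (tyS _ _)   ⊢P Δy vA _ = LevelOf⇒≡ (⊢-resp ⊢P) Δy vA refl
level-of-active-output (tyC _ _)   ⊢P Δy vA _ = LevelOf⇒≡ (⊢-resp ⊢P) Δy vA refl

wt-subst : ∀ {l Γ y1 y2 v1 v2 A B P} → y2 ≢ y1 → l ∣ upd (upd Γ y1 (one A)) y2 (one B) ⊢ P →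
           LevelOf l v1 A → LevelOf l v2 B → wt l (P [ v1 , v2 / y1 , y2 ]) ≡ wt l P
wt-subst {l} {Γ} {y1} {y2} {v1} {v2} {A} {B} {P} y2≢y1 ⊢P v1A v2B =
  wt-ren l _ P (sub2σ-preservesLevels l y1 y2 v1 v2 (os P)
    (level-of-active-output A ⊢P (upd₂-first Γ y1 y2 (one A) (one B) y2≢y1) v1A)
    (level-of-active-output B ⊢P (upd-same _ y2 (one B)) v2B))

LevelOf-unit : ∀ {l v} → LevelOf l v unit
LevelOf-unit = levelOf λ _ ()

data Sends (l : Level) (x v1 v2 : Name) : Ty → Set where
  sends-lin : ∀ {n A B} → LevelOf l v1 A → l x ≡ l v2 → Sends l x v1 v2 (tyO n A B)
  sends-un  : ∀ {n A}   → LevelOf l v1 A → Sends l x v1 v2 (tyC n A)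

data Receives (l : Level) (x v1 v2 : Name) : Ty → Set where
  receives-lin : ∀ {n A B} → LevelOf l v1 A → l x ≡ l v2 → Receives l x v1 v2 (tyI n A B)
  receives-srv : ∀ {n A}   → LevelOf l v1 A → Receives l x v1 v2 (tyS n A)

data InputTy : Ty → Set where
  input-lin : ∀ {n A B} → InputTy (tyI n A B)
  input-srv : ∀ {n A}   → InputTy (tyS n A)

sends⇒receives : ∀ {l x v1 v2 T T'} → Sends l x v1 v2 T → InputTy T' → PairEq T T' →
                 Receives l x v1 v2 T'
sends⇒receives (sends-lin {A = A} v1A x≡v2) input-lin (inj₂ refl) =
  receives-lin (LevelOf-dual A v1A) x≡v2
sends⇒receives (sends-un {A = A} v1A)       input-srv (inj₂ refl) =
  receives-srv (LevelOf-dual A v1A)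
sends⇒receives (sends-lin _ _) input-lin (inj₁ ())
sends⇒receives (sends-lin _ _) input-srv (inj₁ ())
sends⇒receives (sends-lin _ _) input-srv (inj₂ ())
sends⇒receives (sends-un _)    input-lin (inj₁ ())
sends⇒receives (sends-un _)    input-lin (inj₂ ())
sends⇒receives (sends-un _)    input-srv (inj₁ ())

record Sending (l : Level) (x v1 v2 : Name) (w w' : Vector) (T : Ty) : Set where
  constructor sending
  field
    sends   : Sends l x v1 v2 T
    level≥1 : 1 ≤ l x
    weight  : w ≡ w' +V unitV (l x)

record Receiving (l : Level) (x v1 v2 : Name) (w w' : Vector) (T : Ty) : Set where
  constructor receiving
  field
    input  : InputTy T
    growth : Receives l x v1 v2 T → Σ Vector λ ds → w' ≡ w +V ds × Below (l x) ds

output-step : ∀ {l Δ P P' bs x v1 v2} → l ∣ Δ ⊢ P → P —[ outL bs x v1 v2 ]→ P' →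
              Σ Ty λ T → Assigns (Δ x) T × Sending l x v1 v2 (wt l P) (wt l P') T
output-step (t-lin-out {x = x} {n = n} _ sp _ Δx ⊢x Δy1 ⊢y1 _ _ x≡y2) t-out =
  _ , Assigns-splitˡ (sp x) (Assigns-one Δx) ,
  sending (sends-lin (≡⇒LevelOf (⊢v-resp ⊢y1) Δy1 refl) x≡y2)
          (subst (1 ≤_) (sym (⊢v-resp ⊢x x _ _ Δx refl)) (ℕ⁺-pos n)) refl
output-step (t-un-out1 {x = x} {n = n} _ sp _ Δx ⊢x _ _ Δy1 ⊢y1 _ _ _) t-out =
  _ , Assigns-splitˡ (sp x) (Assigns-one Δx) ,
  sending (sends-un (≡⇒LevelOf (⊢v-resp ⊢y1) Δy1 refl))
          (subst (1 ≤_) (sym (⊢v-resp ⊢x x _ _ Δx refl)) (ℕ⁺-pos n)) refl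
output-step (t-un-out2 {x = x} {n = n} _ sp _ Δx ⊢x _ _ Δy1 ⊢y1 _ _ _) t-out =
  _ , Assigns-splitˡ (sp x) (Assigns-pair Δx) ,
  sending (sends-un (≡⇒LevelOf (⊢v-resp ⊢y1) Δy1 refl))
          (subst (1 ≤_) (sym (Assigns-level (⊢v-resp ⊢x) (Assigns-pair Δx) refl)) (ℕ⁺-pos n))
          refl
output-step {l} {x = x} (t-par {Q = Q} _ sp ⊢P _) (t-parL {P' = P'} P→ _)
  with output-step ⊢P P→
... | T , xT , sending s pos P≡ =
  T , Assigns-splitˡ (sp x) xT ,
  sending s pos (trans (cong (_+V wt l Q) P≡) (+V-swapʳ (wt l P') (unitV (l x)) (wt l Q)))
output-step {l} {x = x} (t-par {P = P} _ sp _ ⊢Q) (t-parR {Q' = Q'} Q→ _)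
  with output-step ⊢Q Q→
... | T , xT , sending s pos Q≡ =
  T , Assigns-splitʳ (sp x) xT ,
  sending s pos (trans (cong (wt l P +V_) Q≡) (sym (+V-assoc (wt l P) (wt l Q') (unitV (l x)))))
output-step {Δ = Δ} {bs = bs} {x} (t-res {x = y} _ _ ⊢P) (t-res P→ y∉α)
  with output-step ⊢P P→
... | T , xT , step =
  T , subst (λ m → Assigns m T) (upd-other Δ y _ x λ x≡y → y∉α (∈-++⁺ʳ bs (here (sym x≡y)))) xT ,
  step
output-step {Δ = Δ} {x = x} (t-res {x = y} _ _ ⊢P) (t-open P→ _ _ y≢x)
  with output-step ⊢P P→
... | T , xT , step = T , subst (λ m → Assigns m T) (upd-other Δ y _ x (≢-sym y≢x)) xT , step

server-receiving : ∀ {l x y1 y2 v1 v2 n V Γ P} → l x ≡ val n → y2 ≢ y1 →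
                   l ∣ upd (upd Γ y1 (one V)) y2 (one unit) ⊢ P → (∀ b → b ∈ os P → l b < val n) →
                   Receiving l x v1 v2 [] (wt l (P [ v1 , v2 / y1 , y2 ])) (tyS n V)
server-receiving {l} {x} {P = P} x≡n y2≢y1 ⊢P os<n =
  receiving input-srv λ { (receives-srv v1A) →
    _ , refl , subst (Below (l x)) (sym (wt-subst y2≢y1 ⊢P v1A LevelOf-unit)) body-below }
  where
  body-below : Below (l x) (wt l P)
  body-below = wt-below l (l x) P λ b b∈ → subst (l b <_) (sym x≡n) (os<n b b∈)

linear-receiving : ∀ {l x y1 y2 v1 v2 T Γ A B P} → y2 ≢ y1 →
                   l ∣ upd (upd Γ y1 (one A)) y2 (one B) ⊢ P → InputTy T →
                   (Receives l x v1 v2 T → LevelOf l v1 A × LevelOf l v2 B) →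
                   Receiving l x v1 v2 (wt l P) (wt l (P [ v1 , v2 / y1 , y2 ])) T
linear-receiving y2≢y1 ⊢P T-input levels = receiving T-input λ r →
  [] , trans (wt-subst y2≢y1 ⊢P (proj₁ (levels r)) (proj₂ (levels r))) (sym (+V-identityʳ _)) ,
  λ j _ → at-[] j

input-step : ∀ {l Δ Q Q' x v1 v2} → l ∣ Δ ⊢ Q → Q —[ inL x v1 v2 ]→ Q' →
             Σ Ty λ T → Assigns (Δ x) T × Receiving l x v1 v2 (wt l Q) (wt l Q') T
input-step {x = x} (t-lin-in1 {y2 = y2} _ sp Δx _ _ _ y2≢y1 ⊢P x≡y2) t-in =
  _ , Assigns-splitˡ (sp x) (Assigns-one Δx) ,
  linear-receiving y2≢y1 ⊢P input-lin λ { (receives-lin v1A x≡v2) →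
    v1A , ≡⇒LevelOf {y = y2} (⊢-resp ⊢P) (upd-same _ y2 _) (trans (sym x≡v2) x≡y2) }
input-step {x = x} (t-lin-in2 _ sp Δx _ _ _ _ y2≢y1 ⊢P) t-in =
  _ , Assigns-splitˡ (sp x) (Assigns-one Δx) ,
  linear-receiving y2≢y1 ⊢P input-srv λ { (receives-srv v1A) → v1A , LevelOf-unit }
input-step (t-lin-in3 _ Δx _ _ _ y2≢y1 ⊢P) t-in =
  _ , Assigns-pair Δx ,
  linear-receiving y2≢y1 ⊢P input-srv λ { (receives-srv v1A) → v1A , LevelOf-unit }
input-step {x = x} (t-un-in1 rs Δx _ _ _ y2≢y1 ⊢P os<n) t-rep =
  _ , Assigns-one Δx , server-receiving (rs x _ _ Δx refl) y2≢y1 ⊢P os<n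
input-step (t-un-in2 rs Δx _ _ _ y2≢y1 ⊢P os<n) t-rep =
  _ , Assigns-pair Δx , server-receiving (Assigns-level rs (Assigns-pair Δx) refl) y2≢y1 ⊢P os<n
input-step {l} {x = x} (t-par {P = P} {Q = Q} _ sp ⊢P _) (t-parL P→ _)
  with input-step ⊢P P→
... | T , xT , receiving T-input growth =
  T , Assigns-splitˡ (sp x) xT , receiving T-input λ r → let (ds , P'≡ , ds<) = growth r in
    ds , trans (cong (_+V wt l Q) P'≡) (+V-swapʳ (wt l P) ds (wt l Q)) , ds<
input-step {l} {x = x} (t-par {P = P} {Q = Q} _ sp _ ⊢Q) (t-parR Q→ _)
  with input-step ⊢Q Q→
... | T , xT , receiving T-input growth =
  T , Assigns-splitʳ (sp x) xT , receiving T-input λ r → let (ds , Q'≡ , ds<) = growth r in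
    ds , trans (cong (wt l P +V_) Q'≡) (sym (+V-assoc (wt l P) (wt l Q) ds)) , ds<
input-step {Δ = Δ} {x = x} (t-res {x = y} _ _ ⊢P) (t-res P→ y∉α)
  with input-step ⊢P P→
... | T , xT , step =
  T , subst (λ m → Assigns m T) (upd-other Δ y _ x λ x≡y → y∉α (here (sym x≡y))) xT , step

communication-≺ : ∀ {l x v1 v2 S S' R R' T T'} →
                  Sending l x v1 v2 S S' T → Receiving l x v1 v2 R R' T' → PairEq T T' →
                  (S' +V R') ≺ (S +V R)
communication-≺ (sending s pos S≡) (receiving T'-input growth) TT'
  with growth (sends⇒receives s T'-input TT')
... | ds , R'≡ , ds< = handshake-≺ pos ds< S≡ R'≡

wt-decreases : ∀ {l Δ P P'} → l ∣ Δ ⊢ P → P —[ τ ]→ P' → wt l P' ≺ wt l P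
wt-decreases {l} (t-par _ _ ⊢P _) (t-parL {Q = Q} P→ _) = ≺-+V-monoˡ (wt l Q) (wt-decreases ⊢P P→)
wt-decreases {l} (t-par _ _ _ ⊢Q) (t-parR {P = P} Q→ _) = ≺-+V-monoʳ (wt l P) (wt-decreases ⊢Q Q→)
wt-decreases (t-res _ _ ⊢P) (t-res P→ _) = wt-decreases ⊢P P→
wt-decreases {l} (t-par _ sp ⊢P ⊢Q) (t-comL {bs = bs} {x} P→ Q→ _)
  with output-step ⊢P P→ | input-step ⊢Q Q→
... | _ , xT , send | _ , xT' , receive =
  subst (_≺ _) (sym (wt-nus l bs _))
    (communication-≺ send receive
      (Assigns-unique (Assigns-splitˡ (sp x) xT) (Assigns-splitʳ (sp x) xT')))
wt-decreases {l} (t-par {P = P} {Q = Q} _ sp ⊢P ⊢Q)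
                 (t-comR {P' = P'} {Q' = Q'} {bs = bs} {x} Q→ P→ _)
  with output-step ⊢Q Q→ | input-step ⊢P P→
... | _ , xT , send | _ , xT' , receive =
  subst₂ _≺_ (trans (+V-comm (wt l Q') (wt l P')) (sym (wt-nus l bs _))) (+V-comm (wt l Q) (wt l P))
    (communication-≺ send receive
      (Assigns-unique (Assigns-splitʳ (sp x) xT) (Assigns-splitˡ (sp x) xT')))

mainTheorem2 : (l : Level) (Γ : Ctx) (P P' : Proc) →
    FiniteCtx Γ → l ∣ Γ ⊢ P → P —[ τ ]→ P' → wt l P' ≺ wt l P
mainTheorem2 l Γ P P' _ ⊢P P→ = wt-decreases ⊢P P→
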